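{- Let $L$ and $R$ be nonempty subsets of a group $G$ and let $s\in G$. If $k_s$ is the minimum weak connection length in $\langle L\rangle s\langle R\rangle$, then the double coset $\langle L\rangle s\langle R\rangle$ within $2\mathrm{S}(G;L,R)$ consists of exactly $k_s$ weakly connected components (infinitely many if $k_s$ is infinite), all of the same size. Moreover, if $L\cap N_G(L)\neq\emptyset$ or $R\cap N_G(R)\neq\emptyset$, then all weakly connected components within the same double coset are isomorphic as digraphs.
   Context: For a group $G$ and nonempty subsets $L,R\subseteq G$, the two-sided group digraph $2\mathrm{S}(G;L,R)$ has vertex set $G$ and a directed arc $(g,h)$ if and only if $h=l^{ -1}gr$ for some $l\in L$, $r\in R$. A vertex $g$ is weakly connected to $h$ (written $g\sim h$) if there is a sequence $g=g_0,\dots,g_n=h$ such that for each $i$ either $(g_{i-1},g_i)$ or $(g_i,g_{i-1})$ is an arc; weakly connected components are the equivalence classes of $\sim$. $\langle X\rangle$ denotes the subgroup generated by $X$. A word in a nonempty set $S$ of length $n>0$ is a product $s_1\cdots s_n$ with all $s_i\in S$; $L^{ -1}=\{l^{ -1}:l\in L\}$. The minimum weak connection length in $\langle L\rangle s\langle R\rangle$ is the minimum length $k_s\geq1$ of a word $w$ purely in $L$ or purely in $L^{ -1}$ such that $ws\sim s$ in $2\mathrm{S}(G;L,R)$ (equivalently, the minimum length of a word $w$ purely in $R$ or purely in $R^{ -1}$ with $sw\sim s$), and is infinite if there is no such word. For $X\subseteq G$, $N_G(X)=\{g\in G: gXg^{ -1}=X\}$. -}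

module Defs where

open import Level using (Level; _⊔_)
open import Algebra.Bundles using (Group)
open import Data.Nat using (ℕ; suc; _≤_; _<_)
open import Data.Fin using (Fin)
open import Data.Vec using (Vec; []; _∷_)
open import Data.Vec.Relation.Unary.All using (All)
open import Data.Product using (Σ; ∃; _×_; proj₁)
open import Data.Sum using (_⊎_)
open import Relation.Unary using (Pred)
open import Relation.Nullary using (¬_)
open import Relation.Binary.PropositionalEquality using (_≡_; _≢_)
open import Relation.Binary.Bundles using (Setoid)
import Relation.Binary.Construct.On as On
open import Function.Bundles using (Inverse; _⇔_)

module TwoSided {c ℓ p} (G : Group c ℓ) (L R : Pred (Group.Carrier G) p) where
  open Group G

  Arc : Carrier → Carrier → Set (c ⊔ ℓ ⊔ p)
  Arc g h = Σ Carrier λ l → Σ Carrier λ r → L l × R r × (h ≈ (l ⁻¹ ∙ g) ∙ r)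

  infix 4 _∼_
  data _∼_ : Carrier → Carrier → Set (c ⊔ ℓ ⊔ p) where
    here : ∀ {x y} → x ≈ y → x ∼ y
    fwd  : ∀ {x y z} → Arc x y → y ∼ z → x ∼ z
    bwd  : ∀ {x y z} → Arc y x → y ∼ z → x ∼ z

  data ⟨_⟩ {q} (X : Pred Carrier q) : Carrier → Set (c ⊔ ℓ ⊔ q) where
    gen  : ∀ {x} → X x → ⟨ X ⟩ x
    unit : ⟨ X ⟩ ε
    mul  : ∀ {x y} → ⟨ X ⟩ x → ⟨ X ⟩ y → ⟨ X ⟩ (x ∙ y)
    inv  : ∀ {x} → ⟨ X ⟩ x → ⟨ X ⟩ (x ⁻¹)
    resp : ∀ {x y} → x ≈ y → ⟨ X ⟩ x → ⟨ X ⟩ y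

  DC : Carrier → Pred Carrier (c ⊔ ℓ ⊔ p)
  DC s x = Σ Carrier λ a → Σ Carrier λ b → ⟨ L ⟩ a × ⟨ R ⟩ b × (x ≈ (a ∙ s) ∙ b)

  Inv : Pred Carrier p → Pred Carrier (c ⊔ ℓ ⊔ p)
  Inv X y = Σ Carrier λ x → X x × (y ≈ x ⁻¹)

  prod : ∀ {n} → Vec Carrier n → Carrier
  prod []       = ε
  prod (x ∷ xs) = x ∙ prod xs

  -- w is a word of length n in the set S (n > 0 is required separately)
  IsWord : ∀ {q} → Pred Carrier q → ℕ → Carrier → Set (c ⊔ ℓ ⊔ q)
  IsWord S n w = Σ (Vec Carrier n) λ v → All S v × (w ≈ prod v)

  ConnectsAt : Carrier → ℕ → Set (c ⊔ ℓ ⊔ p)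
  ConnectsAt s n = Σ Carrier λ w → (IsWord L n w ⊎ IsWord (Inv L) n w) × ((w ∙ s) ∼ s)

  IsMinWCL : Carrier → ℕ → Set (c ⊔ ℓ ⊔ p)
  IsMinWCL s k = (1 ≤ k) × ConnectsAt s k × (∀ j → 1 ≤ j → j < k → ¬ ConnectsAt s j)

  NoWCL : Carrier → Set (c ⊔ ℓ ⊔ p)
  NoWCL s = ∀ k → 1 ≤ k → ¬ ConnectsAt s k

  ExactlyComponents : Carrier → ℕ → Set (c ⊔ ℓ ⊔ p)
  ExactlyComponents s k =
    Σ (Fin k → Carrier) λ rep →
      (∀ i → DC s (rep i)) ×
      (∀ i j → rep i ∼ rep j → i ≡ j) ×
      (∀ x → DC s x → ∃ λ i → x ∼ rep i)

  InfinitelyManyComponents : Carrier → Set (c ⊔ ℓ ⊔ p)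
  InfinitelyManyComponents s =
    Σ (ℕ → Carrier) λ f → (∀ i → DC s (f i)) × (∀ i j → i ≢ j → ¬ (f i ∼ f j))

  -- the weakly connected component of x, as a setoid
  Comp : Carrier → Setoid (c ⊔ ℓ ⊔ p) ℓ
  Comp x = On.setoid setoid (proj₁ {B = λ z → z ∼ x})

  SameSize : Carrier → Carrier → Set (c ⊔ ℓ ⊔ p)
  SameSize x y = Inverse (Comp x) (Comp y)

  IsoComponents : Carrier → Carrier → Set (c ⊔ ℓ ⊔ p)
  IsoComponents x y =
    Σ (Inverse (Comp x) (Comp y)) λ φ →
      ∀ a b → Arc (proj₁ a) (proj₁ b) ⇔ Arc (proj₁ (Inverse.to φ a)) (proj₁ (Inverse.to φ b))

  N : Pred Carrier p → Pred Carrier (c ⊔ ℓ ⊔ p)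
  N X g = (∀ x → X x → X ((g ∙ x) ∙ g ⁻¹)) ×
          (∀ x → X x → Σ Carrier λ y → X y × (x ≈ (g ∙ y) ∙ g ⁻¹))

module Submission where

-- Every arc gives l ∙ x ∼ x ∙ r, so all generators l ∈ L act
--    alike up to ∼ (l ∙ x ∼ l₀ ∙ x), and so do their inverses.  Consequently
--    left translation by any a ∈ ⟨L⟩ preserves ∼, and right multiplication by
--    b ∈ ⟨R⟩ can be traded for a left multiplication by some a ∈ ⟨L⟩; hence
--    every x ∈ ⟨L⟩s⟨R⟩ is weakly connected to a ∙ s for some a ∈ ⟨L⟩.
-- 2. Powers of l₀.  A word of length n in L (resp. L⁻¹) acts like l₀ⁿ (resp.
--    l₀⁻ⁿ), so "some word of length k connects s" means s ∼ l₀ᵏ s, and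
--    l₀ⁱ s ∼ l₀ʲ s (i < j) yields a connecting word of length j ∸ i.
-- 3. Counting.  With k minimal, l₀⁰s, …, l₀ᵏ⁻¹s lie in distinct components,
--    and every a ∈ ⟨L⟩ permutes this cycle up to ∼, so they cover the double
--    coset; with no k, all l₀ⁱ s are pairwise non-connected.
-- 4. Shape.  Translation by a ∈ ⟨L⟩ is a bijection between components (same
--    size).  If some l ∈ L normalises L (or r ∈ R normalises R), left
--    multiplication by l (right multiplication by r⁻¹) is a digraph automorphism
--    of 2S(G;L,R), which makes all components of the double coset isomorphic.

open import Algebra.Bundles using (Group)
import Algebra.Properties.Group as GroupProperties
open import Data.Nat using (ℕ; zero; suc; _+_; _∸_; _≤_; _<_; z≤n; s≤s)
open import Data.Nat.Properties
  using (<-cmp; m+[n∸m]≡n; m∸n≤m; m<n⇒0<n∸m; <⇒≤; ≤-<-trans; m≤n⇒m<n∨m≡n; n<1+n; m≤m+n; m≤n+m)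
open import Data.Fin using (Fin; toℕ; fromℕ<)
open import Data.Fin.Properties using (toℕ-injective; toℕ<n; toℕ-fromℕ<)
open import Data.Vec using (Vec; _∷_; replicate)
open import Data.Vec.Relation.Unary.All using (All; []; _∷_)
open import Data.Product using (Σ; ∃; _×_; _,_; proj₁; proj₂)
open import Data.Sum using (_⊎_; inj₁; inj₂)
open import Data.Empty using (⊥-elim)
open import Function.Bundles using (Inverse; _⇔_; mk⇔; Equivalence)
open import Relation.Unary using (Pred)
open import Relation.Nullary using (¬_)
open import Relation.Binary.Definitions using (_Respects_; tri<; tri≈; tri>)
open import Relation.Binary.PropositionalEquality as PE using (_≡_; _≢_)
import Relation.Binary.Reasoning.Setoid as SetoidReasoning

open import Defs

module WeakConnectivity {c ℓ p} (G : Group c ℓ) (L R : Pred (Group.Carrier G) p) where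
  open Group G
  open TwoSided G L R
  open GroupProperties G using (ε⁻¹≈ε; ⁻¹-involutive; ⁻¹-anti-homo-∙)
    renaming (\\-leftDividesʳ to x⁻¹∙[x∙y]≈y; //-rightDividesˡ to [y∙x⁻¹]∙x≈y)
  open SetoidReasoning setoid

  arc-resp : ∀ {x x' y y'} → x ≈ x' → y ≈ y' → Arc x y → Arc x' y'
  arc-resp ex ey (l , r , hl , hr , e) =
    l , r , hl , hr , trans (sym ey) (trans e (∙-congʳ (∙-congˡ ex)))

  ∼-refl : ∀ {x} → x ∼ x
  ∼-refl = here refl

  arc⇒∼ : ∀ {x y} → Arc x y → x ∼ y
  arc⇒∼ a = fwd a ∼-refl

  ∼-respˡ : ∀ {x x' y} → x ≈ x' → x' ∼ y → x ∼ y
  ∼-respˡ e (here e')  = here (trans e e')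
  ∼-respˡ e (fwd a q)  = fwd (arc-resp (sym e) refl a) q
  ∼-respˡ e (bwd a q)  = bwd (arc-resp refl (sym e) a) q

  ∼-trans : ∀ {x y z} → x ∼ y → y ∼ z → x ∼ z
  ∼-trans (here e)  q = ∼-respˡ e q
  ∼-trans (fwd a p) q = fwd a (∼-trans p q)
  ∼-trans (bwd a p) q = bwd a (∼-trans p q)

  ∼-sym : ∀ {x y} → x ∼ y → y ∼ x
  ∼-sym (here e)  = here (sym e)
  ∼-sym (fwd a p) = ∼-trans (∼-sym p) (bwd a ∼-refl)
  ∼-sym (bwd a p) = ∼-trans (∼-sym p) (arc⇒∼ a)

  ∼-resp : ∀ {x x' y y'} → x ≈ x' → y ≈ y' → x ∼ y → x' ∼ y'
  ∼-resp ex ey q = ∼-respˡ (sym ex) (∼-trans q (here ey))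

  ∼-map : (f : Carrier → Carrier) → (∀ {x y} → x ≈ y → f x ≈ f y) →
          (∀ {x y} → Arc x y → f x ∼ f y) → ∀ {x y} → x ∼ y → f x ∼ f y
  ∼-map f f-cong f-arc (here e)  = here (f-cong e)
  ∼-map f f-cong f-arc (fwd a q) = ∼-trans (f-arc a) (∼-map f f-cong f-arc q)
  ∼-map f f-cong f-arc (bwd a q) = ∼-trans (∼-sym (f-arc a)) (∼-map f f-cong f-arc q)

  -- Induction over a generated subgroup: a ≈-invariant property of ε, of the
  -- generators and of their inverses, closed under products, holds on ⟨ X ⟩.
  -- (Internally one proves P a and P (a ⁻¹) simultaneously.)
  subgroup-ind : ∀ {q r} {X : Pred Carrier q} (P : Pred Carrier r) →
    (∀ {x y} → x ≈ y → P x → P y) → P ε →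
    (∀ {x y} → ⟨ X ⟩ x → P x → P y → P (x ∙ y)) →
    (∀ {x} → X x → P x) → (∀ {x} → X x → P (x ⁻¹)) →
    ∀ {a} → ⟨ X ⟩ a → P a
  subgroup-ind {X = X} P P-resp P-ε P-∙ P-gen P-gen⁻¹ ha = proj₁ (with-inverse ha)
    where
      with-inverse : ∀ {a} → ⟨ X ⟩ a → P a × P (a ⁻¹)
      with-inverse (gen hx) = P-gen hx , P-gen⁻¹ hx
      with-inverse unit     = P-ε , P-resp (sym ε⁻¹≈ε) P-ε
      with-inverse (mul {a} {b} ha hb) =
        let (Pa , Pa⁻¹) = with-inverse ha ; (Pb , Pb⁻¹) = with-inverse hb in
        P-∙ ha Pa Pb , P-resp (sym (⁻¹-anti-homo-∙ a b)) (P-∙ (inv hb) Pb⁻¹ Pa⁻¹)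
      with-inverse (inv {a} ha) =
        let (Pa , Pa⁻¹) = with-inverse ha in Pa⁻¹ , P-resp (sym (⁻¹-involutive a)) Pa
      with-inverse (resp e ha) =
        let (Pa , Pa⁻¹) = with-inverse ha in P-resp e Pa , P-resp (⁻¹-cong e) Pa⁻¹

  ∼⇒iso : ∀ {x y} → x ∼ y → IsoComponents x y
  ∼⇒iso q = record
    { to = λ a → proj₁ a , ∼-trans (proj₂ a) q
    ; from = λ a → proj₁ a , ∼-trans (proj₂ a) (∼-sym q)
    ; to-cong = λ e → e ; from-cong = λ e → e ; inverse = (λ e → e) , (λ e → e) }
    , λ a b → mk⇔ (λ r → r) (λ r → r)

  iso-trans : ∀ {x y z} → IsoComponents x y → IsoComponents y z → IsoComponents x z
  iso-trans (φ , φ-arcs) (ψ , ψ-arcs) = record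
    { to = λ a → Inverse.to ψ (Inverse.to φ a)
    ; from = λ a → Inverse.from φ (Inverse.from ψ a)
    ; to-cong = λ e → Inverse.to-cong ψ (Inverse.to-cong φ e)
    ; from-cong = λ e → Inverse.from-cong φ (Inverse.from-cong ψ e)
    ; inverse = (λ e → Inverse.inverseˡ ψ (Inverse.inverseˡ φ e))
              , (λ e → Inverse.inverseʳ φ (Inverse.inverseʳ ψ e)) }
    , λ a b → mk⇔ (λ r → Equivalence.to (ψ-arcs _ _) (Equivalence.to (φ-arcs a b) r))
                  (λ r → Equivalence.from (φ-arcs a b) (Equivalence.from (ψ-arcs _ _) r))

  iso-sym : ∀ {x y} → IsoComponents x y → IsoComponents y x
  iso-sym (φ , φ-arcs) = record
    { to = Inverse.from φ ; from = Inverse.to φ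
    ; to-cong = Inverse.from-cong φ ; from-cong = Inverse.to-cong φ
    ; inverse = Inverse.inverseʳ φ , Inverse.inverseˡ φ }
    , λ a b → mk⇔ (λ r → Equivalence.from (φ-arcs _ _) (arc-resp (sym (to∘from a)) (sym (to∘from b)) r))
                  (λ r → arc-resp (to∘from a) (to∘from b) (Equivalence.to (φ-arcs _ _) r))
    where
      to∘from : ∀ a → proj₁ (Inverse.to φ (Inverse.from φ a)) ≈ proj₁ a
      to∘from a = Inverse.inverseˡ φ refl

  automorphism-iso : (f g : Carrier → Carrier) →
    (∀ {a b} → a ≈ b → f a ≈ f b) → (∀ {a b} → a ≈ b → g a ≈ g b) →
    (∀ w → f (g w) ≈ w) → (∀ w → g (f w) ≈ w) →
    (∀ a b → Arc a b ⇔ Arc (f a) (f b)) → ∀ z → IsoComponents z (f z)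
  automorphism-iso f g f-cong g-cong fg gf f-arcs z = record
    { to = λ a → f (proj₁ a) , f-∼ (proj₂ a)
    ; from = λ a → g (proj₁ a) , ∼-trans (g-∼ (proj₂ a)) (here (gf z))
    ; to-cong = f-cong ; from-cong = g-cong
    ; inverse = (λ e → trans (f-cong e) (fg _)) , (λ e → trans (g-cong e) (gf _)) }
    , λ a b → f-arcs (proj₁ a) (proj₁ b)
    where
      f-∼ : ∀ {a b} → a ∼ b → f a ∼ f b
      f-∼ = ∼-map f f-cong (λ ar → arc⇒∼ (Equivalence.to (f-arcs _ _) ar))
      g-arc : ∀ {a b} → Arc a b → Arc (g a) (g b)
      g-arc ar = Equivalence.from (f-arcs _ _) (arc-resp (sym (fg _)) (sym (fg _)) ar)
      g-∼ : ∀ {a b} → a ∼ b → g a ∼ g b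
      g-∼ = ∼-map g g-cong (λ ar → arc⇒∼ (g-arc ar))

  conj-left : ∀ u l x → ((u ∙ l) ∙ u ⁻¹) ⁻¹ ∙ (u ∙ x) ≈ u ∙ (l ⁻¹ ∙ x)
  conj-left u l x = begin
    ((u ∙ l) ∙ u ⁻¹) ⁻¹ ∙ (u ∙ x)    ≈⟨ ∙-congʳ (⁻¹-anti-homo-∙ _ _) ⟩
    (u ⁻¹ ⁻¹ ∙ (u ∙ l) ⁻¹) ∙ (u ∙ x) ≈⟨ ∙-congʳ (∙-cong (⁻¹-involutive u) (⁻¹-anti-homo-∙ u l)) ⟩
    (u ∙ (l ⁻¹ ∙ u ⁻¹)) ∙ (u ∙ x)    ≈⟨ assoc _ _ _ ⟩
    u ∙ ((l ⁻¹ ∙ u ⁻¹) ∙ (u ∙ x))    ≈⟨ ∙-congˡ (assoc _ _ _) ⟩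
    u ∙ (l ⁻¹ ∙ (u ⁻¹ ∙ (u ∙ x)))    ≈⟨ ∙-congˡ (∙-congˡ (x⁻¹∙[x∙y]≈y u x)) ⟩
    u ∙ (l ⁻¹ ∙ x)                   ∎

  conj-right : ∀ y u r → (y ∙ u ⁻¹) ∙ ((u ∙ r) ∙ u ⁻¹) ≈ (y ∙ r) ∙ u ⁻¹
  conj-right y u r = begin
    (y ∙ u ⁻¹) ∙ ((u ∙ r) ∙ u ⁻¹) ≈⟨ sym (assoc _ _ _) ⟩
    ((y ∙ u ⁻¹) ∙ (u ∙ r)) ∙ u ⁻¹ ≈⟨ ∙-congʳ (sym (assoc _ _ _)) ⟩
    (((y ∙ u ⁻¹) ∙ u) ∙ r) ∙ u ⁻¹ ≈⟨ ∙-congʳ (∙-congʳ ([y∙x⁻¹]∙x≈y u y)) ⟩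
    (y ∙ r) ∙ u ⁻¹                ∎

  normaliserL-arcs : ∀ {u} → N L u → ∀ a b → Arc a b ⇔ Arc (u ∙ a) (u ∙ b)
  normaliserL-arcs {u} (conj-in , conj-onto) a b = mk⇔ to from
    where
      to : Arc a b → Arc (u ∙ a) (u ∙ b)
      to (l , r , hl , hr , e) = (u ∙ l) ∙ u ⁻¹ , r , conj-in l hl , hr , (begin
        u ∙ b                                  ≈⟨ ∙-congˡ e ⟩
        u ∙ ((l ⁻¹ ∙ a) ∙ r)                   ≈⟨ sym (assoc _ _ _) ⟩
        (u ∙ (l ⁻¹ ∙ a)) ∙ r                   ≈⟨ ∙-congʳ (sym (conj-left u l a)) ⟩
        (((u ∙ l) ∙ u ⁻¹) ⁻¹ ∙ (u ∙ a)) ∙ r    ∎)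
      from : Arc (u ∙ a) (u ∙ b) → Arc a b
      from (l' , r , hl' , hr , e) with conj-onto l' hl'
      ... | l , hl , l'≈ = l , r , hl , hr , (begin
        b                                           ≈⟨ sym (x⁻¹∙[x∙y]≈y u b) ⟩
        u ⁻¹ ∙ (u ∙ b)                              ≈⟨ ∙-congˡ e ⟩
        u ⁻¹ ∙ ((l' ⁻¹ ∙ (u ∙ a)) ∙ r)              ≈⟨ ∙-congˡ (∙-congʳ (∙-congʳ (⁻¹-cong l'≈))) ⟩
        u ⁻¹ ∙ ((((u ∙ l) ∙ u ⁻¹) ⁻¹ ∙ (u ∙ a)) ∙ r) ≈⟨ ∙-congˡ (∙-congʳ (conj-left u l a)) ⟩
        u ⁻¹ ∙ ((u ∙ (l ⁻¹ ∙ a)) ∙ r)               ≈⟨ ∙-congˡ (assoc _ _ _) ⟩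
        u ⁻¹ ∙ (u ∙ ((l ⁻¹ ∙ a) ∙ r))               ≈⟨ x⁻¹∙[x∙y]≈y _ _ ⟩
        (l ⁻¹ ∙ a) ∙ r                              ∎)

  normaliserR-arcs : ∀ {u} → N R u → ∀ a b → Arc a b ⇔ Arc (a ∙ u ⁻¹) (b ∙ u ⁻¹)
  normaliserR-arcs {u} (conj-in , conj-onto) a b = mk⇔ to from
    where
      to : Arc a b → Arc (a ∙ u ⁻¹) (b ∙ u ⁻¹)
      to (l , r , hl , hr , e) = l , (u ∙ r) ∙ u ⁻¹ , hl , conj-in r hr , (begin
        b ∙ u ⁻¹                                 ≈⟨ ∙-congʳ e ⟩
        ((l ⁻¹ ∙ a) ∙ r) ∙ u ⁻¹                  ≈⟨ sym (conj-right _ _ _) ⟩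
        ((l ⁻¹ ∙ a) ∙ u ⁻¹) ∙ ((u ∙ r) ∙ u ⁻¹)   ≈⟨ ∙-congʳ (assoc _ _ _) ⟩
        (l ⁻¹ ∙ (a ∙ u ⁻¹)) ∙ ((u ∙ r) ∙ u ⁻¹)   ∎)
      from : Arc (a ∙ u ⁻¹) (b ∙ u ⁻¹) → Arc a b
      from (l , r' , hl , hr' , e) with conj-onto r' hr'
      ... | r , hr , r'≈ = l , r , hl , hr , (begin
        b                                                ≈⟨ sym ([y∙x⁻¹]∙x≈y u b) ⟩
        (b ∙ u ⁻¹) ∙ u                                   ≈⟨ ∙-congʳ e ⟩
        ((l ⁻¹ ∙ (a ∙ u ⁻¹)) ∙ r') ∙ u                   ≈⟨ ∙-congʳ (∙-cong (sym (assoc _ _ _)) r'≈) ⟩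
        (((l ⁻¹ ∙ a) ∙ u ⁻¹) ∙ ((u ∙ r) ∙ u ⁻¹)) ∙ u     ≈⟨ ∙-congʳ (conj-right _ _ _) ⟩
        (((l ⁻¹ ∙ a) ∙ r) ∙ u ⁻¹) ∙ u                    ≈⟨ [y∙x⁻¹]∙x≈y _ _ ⟩
        (l ⁻¹ ∙ a) ∙ r                                   ∎)

module Components {c ℓ p} (G : Group c ℓ) (L R : Pred (Group.Carrier G) p)
                  (l₀ : Group.Carrier G) (hl₀ : L l₀) (r₀ : Group.Carrier G) (hr₀ : R r₀) where
  open Group G
  open TwoSided G L R
  open WeakConnectivity G L R
  open GroupProperties G using (ε⁻¹≈ε; ⁻¹-anti-homo-∙)
    renaming ( \\-leftDividesˡ to x∙[x⁻¹∙y]≈y; \\-leftDividesʳ to x⁻¹∙[x∙y]≈y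
             ; //-rightDividesˡ to [y∙x⁻¹]∙x≈y; //-rightDividesʳ to [y∙x]∙x⁻¹≈y)
  open SetoidReasoning setoid

  move : ∀ {l r} x → L l → R r → l ∙ x ∼ x ∙ r
  move {l} {r} x hl hr = arc⇒∼ (l , r , hl , hr , ∙-congʳ (sym (x⁻¹∙[x∙y]≈y l x)))

  move⁻¹ : ∀ {l r} x → L l → R r → x ∙ r ⁻¹ ∼ l ⁻¹ ∙ x
  move⁻¹ {l} {r} x hl hr =
    arc⇒∼ (l , r , hl , hr , trans (∙-congˡ (sym ([y∙x⁻¹]∙x≈y r x))) (sym (assoc _ _ _)))

  -- All generators act alike up to ∼ (compare both with x ∙ r₀).
  generators-agree : ∀ {l l'} x → L l → L l' → l ∙ x ∼ l' ∙ x
  generators-agree x hl hl' = ∼-trans (move x hl hr₀) (∼-sym (move x hl' hr₀))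

  inverses-agree : ∀ {l l'} x → L l → L l' → l ⁻¹ ∙ x ∼ l' ⁻¹ ∙ x
  inverses-agree x hl hl' = ∼-trans (∼-sym (move⁻¹ x hl hr₀)) (move⁻¹ x hl' hr₀)

  -- Left translation by a ∈ ⟨L⟩ preserves weak connectivity.  For a generator
  -- t and an arc y = l⁻¹ x r:  t x ∼ x r ≈ l y ∼ t y, and dually for t⁻¹.
  translate : ∀ {a} → ⟨ L ⟩ a → ∀ {x y} → x ∼ y → a ∙ x ∼ a ∙ y
  translate = subgroup-ind Translates
    (λ e T q → ∼-resp (∙-congʳ e) (∙-congʳ e) (T q))
    (λ q → ∼-resp (sym (identityˡ _)) (sym (identityˡ _)) q)
    (λ _ Ta Tb q → ∼-resp (sym (assoc _ _ _)) (sym (assoc _ _ _)) (Ta (Tb q)))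
    (λ ht → ∼-map _ ∙-congˡ (generator-arc ht))
    (λ ht → ∼-map _ ∙-congˡ (inverse-arc ht))
    where
      Translates : Pred Carrier _
      Translates a = ∀ {x y} → x ∼ y → a ∙ x ∼ a ∙ y
      generator-arc : ∀ {t x y} → L t → Arc x y → t ∙ x ∼ t ∙ y
      generator-arc {t} {x} {y} ht (l , r , hl , hr , e) =
        ∼-trans (move x ht hr) (∼-trans (here xr≈ly) (generators-agree y hl ht))
        where
          xr≈ly : x ∙ r ≈ l ∙ y
          xr≈ly = begin
            x ∙ r                    ≈⟨ ∙-congʳ (sym (x∙[x⁻¹∙y]≈y l x)) ⟩
            (l ∙ (l ⁻¹ ∙ x)) ∙ r     ≈⟨ assoc _ _ _ ⟩
            l ∙ ((l ⁻¹ ∙ x) ∙ r)     ≈⟨ ∙-congˡ (sym e) ⟩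
            l ∙ y                    ∎
      inverse-arc : ∀ {t x y} → L t → Arc x y → t ⁻¹ ∙ x ∼ t ⁻¹ ∙ y
      inverse-arc {t} {x} {y} ht (l , r , hl , hr , e) =
        ∼-trans (inverses-agree x ht hl) (∼-trans (here (sym yr⁻¹≈l⁻¹x)) (move⁻¹ y ht hr))
        where
          yr⁻¹≈l⁻¹x : y ∙ r ⁻¹ ≈ l ⁻¹ ∙ x
          yr⁻¹≈l⁻¹x = trans (∙-congʳ e) ([y∙x]∙x⁻¹≈y r (l ⁻¹ ∙ x))

  -- Right multiplication by b ∈ ⟨R⟩ is, up to ∼, a left multiplication by
  -- some a ∈ ⟨L⟩:  z ∙ r ∼ l₀ ∙ z  and  z ∙ r⁻¹ ∼ l₀⁻¹ ∙ z.
  right-to-left : ∀ {b} → ⟨ R ⟩ b → Σ Carrier λ a → ⟨ L ⟩ a × (∀ z → z ∙ b ∼ a ∙ z)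
  right-to-left = subgroup-ind Traded
    (λ { e (a , ha , f) → a , ha , λ z → ∼-respˡ (∙-congˡ (sym e)) (f z) })
    (ε , unit , λ z → here (trans (identityʳ z) (sym (identityˡ z))))
    (λ { _ (a₁ , h₁ , f₁) (a₂ , h₂ , f₂) → a₂ ∙ a₁ , mul h₂ h₁ , λ z →
      ∼-resp (assoc _ _ _) (sym (assoc _ _ _)) (∼-trans (f₂ (z ∙ _)) (translate h₂ (f₁ z))) })
    (λ hr → l₀ , gen hl₀ , λ z → ∼-sym (move z hl₀ hr))
    (λ hr → l₀ ⁻¹ , inv (gen hl₀) , λ z → move⁻¹ z hl₀ hr)
    where
      Traded : Pred Carrier _
      Traded b = Σ Carrier λ a → ⟨ L ⟩ a × (∀ z → z ∙ b ∼ a ∙ z)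

  coset-representative : ∀ {s x} → DC s x → Σ Carrier λ a → ⟨ L ⟩ a × x ∼ a ∙ s
  coset-representative {s} (a , b , ha , hb , e) with right-to-left hb
  ... | a' , ha' , f = a' ∙ a , mul ha' ha , ∼-respˡ e (∼-trans (f (a ∙ s)) (here (sym (assoc _ _ _))))

  l₀^ : ℕ → Carrier
  l₀^ n = prod (replicate n l₀)

  l₀^-word : ∀ n → All L (replicate n l₀)
  l₀^-word zero    = []
  l₀^-word (suc n) = hl₀ ∷ l₀^-word n

  l₀^∈⟨L⟩ : ∀ n → ⟨ L ⟩ (l₀^ n)
  l₀^∈⟨L⟩ zero    = unit
  l₀^∈⟨L⟩ (suc n) = mul (gen hl₀) (l₀^∈⟨L⟩ n)

  l₀^-+ : ∀ m n → l₀^ (m + n) ≈ l₀^ m ∙ l₀^ n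
  l₀^-+ zero    n = sym (identityˡ _)
  l₀^-+ (suc m) n = trans (∙-congˡ (l₀^-+ m n)) (sym (assoc _ _ _))

  l₀^-comm : ∀ n → l₀^ n ∙ l₀ ≈ l₀ ∙ l₀^ n
  l₀^-comm zero    = trans (identityˡ _) (sym (identityʳ _))
  l₀^-comm (suc n) = trans (assoc _ _ _) (∙-congˡ (l₀^-comm n))

  word-acts-as-power : ∀ {n} {v : Vec Carrier n} → All L v → ∀ z → prod v ∙ z ∼ l₀^ n ∙ z
  word-acts-as-power []                   z = ∼-refl
  word-acts-as-power {v = x ∷ v} (hx ∷ hv) z =
    ∼-resp (sym (assoc _ _ _)) (sym (assoc _ _ _))
      (∼-trans (generators-agree (prod v ∙ z) hx hl₀) (translate (gen hl₀) (word-acts-as-power hv z)))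

  inverse-word-acts-as-power : ∀ {n} {v : Vec Carrier n} → All (Inv L) v → ∀ z →
                               prod v ∙ z ∼ l₀^ n ⁻¹ ∙ z
  inverse-word-acts-as-power [] z = here (∙-congʳ (sym ε⁻¹≈ε))
  inverse-word-acts-as-power {suc n} {y ∷ v} ((x , hx , y≈x⁻¹) ∷ hv) z =
    ∼-resp (sym (trans (assoc _ _ _) (∙-congʳ y≈x⁻¹))) l₀⁻¹[l₀^n⁻¹z]≈
      (∼-trans (inverses-agree (prod v ∙ z) hx hl₀)
               (translate (inv (gen hl₀)) (inverse-word-acts-as-power hv z)))
    where
      l₀⁻¹[l₀^n⁻¹z]≈ : l₀ ⁻¹ ∙ (l₀^ n ⁻¹ ∙ z) ≈ l₀^ (suc n) ⁻¹ ∙ z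
      l₀⁻¹[l₀^n⁻¹z]≈ = begin
        l₀ ⁻¹ ∙ (l₀^ n ⁻¹ ∙ z)   ≈⟨ sym (assoc _ _ _) ⟩
        (l₀ ⁻¹ ∙ l₀^ n ⁻¹) ∙ z   ≈⟨ ∙-congʳ (sym (⁻¹-anti-homo-∙ _ _)) ⟩
        (l₀^ n ∙ l₀) ⁻¹ ∙ z      ≈⟨ ∙-congʳ (⁻¹-cong (l₀^-comm n)) ⟩
        (l₀ ∙ l₀^ n) ⁻¹ ∙ z      ∎

  -- Component isomorphisms z ↦ l ∙ z for every generator l; this is what the
  -- normaliser hypotheses provide.
  GeneratorIsos : Set _
  GeneratorIsos = ∀ {l} → L l → ∀ z → IsoComponents z (l ∙ z)

  -- If u ∈ L normalises L:  component of z ≅ component of u ∙ z (automorphism),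
  -- and u ∙ z ∼ l ∙ z.
  normaliserL-isos : ∀ {u} → L u → N L u → GeneratorIsos
  normaliserL-isos {u} hu nu hl z =
    iso-trans (automorphism-iso (u ∙_) (u ⁻¹ ∙_) ∙-congˡ ∙-congˡ
                                (x∙[x⁻¹∙y]≈y u) (x⁻¹∙[x∙y]≈y u) (normaliserL-arcs nu) z)
              (∼⇒iso (generators-agree z hu hl))

  -- If u ∈ R normalises R:  component of w ≅ component of w ∙ u⁻¹ ∼ l⁻¹ ∙ w;
  -- apply this at w = l ∙ z and invert.
  normaliserR-isos : ∀ {u} → R u → N R u → GeneratorIsos
  normaliserR-isos {u} hu nu {l} hl z =
    iso-sym (iso-trans (inverse-iso (l ∙ z)) (∼⇒iso (here (x⁻¹∙[x∙y]≈y l z))))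
    where
      inverse-iso : ∀ w → IsoComponents w (l ⁻¹ ∙ w)
      inverse-iso w =
        iso-trans (automorphism-iso (_∙ u ⁻¹) (_∙ u) ∙-congʳ ∙-congʳ
                                    ([y∙x]∙x⁻¹≈y u) ([y∙x⁻¹]∙x≈y u) (normaliserR-arcs nu) w)
                  (∼⇒iso (move⁻¹ w hl hu))

  normaliser-isos : (Σ Carrier λ l → L l × N L l) ⊎ (Σ Carrier λ r → R r × N R r) → GeneratorIsos
  normaliser-isos (inj₁ (u , hu , nu)) = normaliserL-isos hu nu
  normaliser-isos (inj₂ (u , hu , nu)) = normaliserR-isos hu nu

  subgroup-isos : GeneratorIsos → ∀ {a} → ⟨ L ⟩ a → ∀ z → IsoComponents z (a ∙ z)
  subgroup-isos isos = subgroup-ind (λ a → ∀ z → IsoComponents z (a ∙ z))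
    (λ e I z → iso-trans (I z) (∼⇒iso (here (∙-congʳ e))))
    (λ z → ∼⇒iso (here (sym (identityˡ z))))
    (λ _ Ia Ib z → iso-trans (Ib z) (iso-trans (Ia (_ ∙ z)) (∼⇒iso (here (sym (assoc _ _ _))))))
    isos
    (λ hl z → iso-sym (iso-trans (isos hl (_ ⁻¹ ∙ z)) (∼⇒iso (here (x∙[x⁻¹∙y]≈y _ z)))))

  module DoubleCoset (s : Carrier) where

    power-in-coset : ∀ n → DC s (l₀^ n ∙ s)
    power-in-coset n = l₀^ n , ε , l₀^∈⟨L⟩ n , unit , sym (identityʳ _)

    -- A connecting word of length k acts like l₀ᵏ or l₀⁻ᵏ, so it puts l₀ᵏ s
    -- in the component of s.
    connects⇒cycle : ∀ {k} → ConnectsAt s k → s ∼ l₀^ k ∙ s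
    connects⇒cycle (w , inj₁ (v , hv , w≈) , ws∼s) =
      ∼-sym (∼-trans (∼-sym (word-acts-as-power hv s)) (∼-respˡ (∙-congʳ (sym w≈)) ws∼s))
    connects⇒cycle {k} (w , inj₂ (v , hv , w≈) , ws∼s) =
      ∼-resp (x∙[x⁻¹∙y]≈y (l₀^ k) s) refl
        (translate (l₀^∈⟨L⟩ k)
          (∼-trans (∼-sym (inverse-word-acts-as-power hv s)) (∼-respˡ (∙-congʳ (sym w≈)) ws∼s)))

    -- Conversely, l₀ⁱ s ∼ l₀ⁱ⁺ᵈ s makes the word l₀ᵈ connecting (translate by l₀⁻ⁱ).
    shift-connects : ∀ i d → l₀^ i ∙ s ∼ l₀^ (i + d) ∙ s → ConnectsAt s d
    shift-connects i d q =
      l₀^ d , inj₁ (replicate d l₀ , l₀^-word d , refl) ,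
      ∼-sym (∼-resp (x⁻¹∙[x∙y]≈y (l₀^ i) s) cancel (translate (inv (l₀^∈⟨L⟩ i)) q))
      where
        cancel : l₀^ i ⁻¹ ∙ (l₀^ (i + d) ∙ s) ≈ l₀^ d ∙ s
        cancel = begin
          l₀^ i ⁻¹ ∙ (l₀^ (i + d) ∙ s)        ≈⟨ ∙-congˡ (∙-congʳ (l₀^-+ i d)) ⟩
          l₀^ i ⁻¹ ∙ ((l₀^ i ∙ l₀^ d) ∙ s)    ≈⟨ ∙-congˡ (assoc _ _ _) ⟩
          l₀^ i ⁻¹ ∙ (l₀^ i ∙ (l₀^ d ∙ s))    ≈⟨ x⁻¹∙[x∙y]≈y _ _ ⟩
          l₀^ d ∙ s                           ∎

    gap-connects : ∀ {i j} → i < j → l₀^ i ∙ s ∼ l₀^ j ∙ s → ConnectsAt s (j ∸ i)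
    gap-connects {i} {j} i<j q =
      shift-connects i (j ∸ i) (PE.subst (λ n → l₀^ i ∙ s ∼ l₀^ n ∙ s) (PE.sym (m+[n∸m]≡n (<⇒≤ i<j))) q)

    powers-apart : ∀ m {i j} → i < m → j < m → (∀ d → 1 ≤ d → d < m → ¬ ConnectsAt s d) →
                   l₀^ i ∙ s ∼ l₀^ j ∙ s → i ≡ j
    powers-apart m {i} {j} i<m j<m no-gap q with <-cmp i j
    ... | tri< i<j _ _ =
      ⊥-elim (no-gap (j ∸ i) (m<n⇒0<n∸m i<j) (≤-<-trans (m∸n≤m j i) j<m) (gap-connects i<j q))
    ... | tri≈ _ i≡j _ = i≡j
    ... | tri> _ _ j<i =
      ⊥-elim (no-gap (i ∸ j) (m<n⇒0<n∸m j<i) (≤-<-trans (m∸n≤m i j) i<m) (gap-connects j<i (∼-sym q)))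

    -- When s ∼ l₀^(m+1) s, the vertices l₀⁰ s, …, l₀ᵐ s form a cycle that
    -- every a ∈ ⟨L⟩ maps into itself up to ∼.
    module Cycle (m : ℕ) (cycle : s ∼ l₀^ (suc m) ∙ s) where

      PreservesCycle : Pred Carrier _
      PreservesCycle a = ∀ i → i < suc m → Σ ℕ λ j → j < suc m × a ∙ (l₀^ i ∙ s) ∼ l₀^ j ∙ s

      preserves-∼ : ∀ {a b} → (∀ z → a ∙ z ∼ b ∙ z) → PreservesCycle b → PreservesCycle a
      preserves-∼ a≃b pb i i<m with pb i i<m
      ... | j , j<m , q = j , j<m , ∼-trans (a≃b _) q

      -- l₀ shifts the cycle forward, wrapping l₀ᵐ s to l₀^(m+1) s ∼ s.
      l₀-preserves : PreservesCycle l₀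
      l₀-preserves i i<m with m≤n⇒m<n∨m≡n i<m
      ... | inj₁ 1+i<m = suc i , 1+i<m , here (sym (assoc _ _ _))
      ... | inj₂ 1+i≡m = 0 , s≤s z≤n , ∼-trans (here (sym (assoc _ _ _)))
            (PE.subst (λ n → l₀^ n ∙ s ∼ l₀^ 0 ∙ s) (PE.sym 1+i≡m) (∼-sym (∼-respˡ (identityˡ s) cycle)))

      -- l₀⁻¹ shifts it backward, wrapping s ∼ l₀^(m+1) s to l₀ᵐ s.
      l₀⁻¹-preserves : PreservesCycle (l₀ ⁻¹)
      l₀⁻¹-preserves zero    _   =
        m , n<1+n m , ∼-resp refl cancel (translate (inv (gen hl₀)) (∼-respˡ (identityˡ s) cycle))
        where
          cancel : l₀ ⁻¹ ∙ (l₀^ (suc m) ∙ s) ≈ l₀^ m ∙ s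
          cancel = trans (∙-congˡ (assoc _ _ _)) (x⁻¹∙[x∙y]≈y _ _)
      l₀⁻¹-preserves (suc i) i<m =
        i , <⇒≤ i<m , here (trans (∙-congˡ (assoc _ _ _)) (x⁻¹∙[x∙y]≈y _ _))

      subgroup-preserves : ∀ {a} → ⟨ L ⟩ a → PreservesCycle a
      subgroup-preserves = subgroup-ind PreservesCycle
        (λ e → preserves-∼ (λ z → here (∙-congʳ (sym e))))
        (λ i i<m → i , i<m , here (identityˡ _))
        compose
        (λ hl → preserves-∼ (λ z → generators-agree z hl hl₀) l₀-preserves)
        (λ hl → preserves-∼ (λ z → inverses-agree z hl hl₀) l₀⁻¹-preserves)
        where
          compose : ∀ {a b} → ⟨ L ⟩ a → PreservesCycle a → PreservesCycle b → PreservesCycle (a ∙ b)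
          compose ha pa pb i i<m with pb i i<m
          ... | j , j<m , q with pa j j<m
          ... | j' , j'<m , q' = j' , j'<m , ∼-respˡ (assoc _ _ _) (∼-trans (translate ha q) q')

      lands-on-cycle : ∀ {a} → ⟨ L ⟩ a → Σ (Fin (suc m)) λ i → a ∙ s ∼ l₀^ (toℕ i) ∙ s
      lands-on-cycle ha with subgroup-preserves ha 0 (s≤s z≤n)
      ... | j , j<m , q = fromℕ< j<m ,
        ∼-resp (∙-congˡ (identityˡ s)) (∙-congʳ (reflexive (PE.cong l₀^ (PE.sym (toℕ-fromℕ< j<m))))) q

    -- Finite minimal length k: l₀⁰ s, …, l₀ᵏ⁻¹ s represent the components,
    -- distinct by minimality of k and covering since s ∼ l₀ᵏ s closes the cycle.
    exactly-components : ∀ k → IsMinWCL s k → ExactlyComponents s k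
    exactly-components zero    (() , _)
    exactly-components (suc m) (_ , connects , minimal) =
      (λ i → l₀^ (toℕ i) ∙ s) , (λ i → power-in-coset (toℕ i)) , apart , covered
      where
        apart : ∀ i j → l₀^ (toℕ i) ∙ s ∼ l₀^ (toℕ j) ∙ s → i ≡ j
        apart i j q = toℕ-injective (powers-apart (suc m) (toℕ<n i) (toℕ<n j) minimal q)
        covered : ∀ x → DC s x → ∃ λ i → x ∼ l₀^ (toℕ i) ∙ s
        covered x dx with coset-representative dx
        ... | a , ha , x∼as with Cycle.lands-on-cycle m (connects⇒cycle connects) ha
        ... | i , as∼ = i , ∼-trans x∼as as∼

    infinitely-many : NoWCL s → InfinitelyManyComponents s
    infinitely-many none = (λ i → l₀^ i ∙ s) , power-in-coset , apart
      where
        apart : ∀ i j → i ≢ j → ¬ (l₀^ i ∙ s ∼ l₀^ j ∙ s)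
        apart i j i≢j q =
          i≢j (powers-apart (suc (i + j)) (s≤s (m≤m+n i j)) (s≤s (m≤n+m j i)) (λ d d≥1 _ → none d d≥1) q)

    -- Any two components in the double coset are related by a translation
    -- g = a₂ a₁⁻¹ ∈ ⟨L⟩ where x ∼ a₁ s, y ∼ a₂ s.
    translation-between : ∀ {x y} → DC s x → DC s y → Σ Carrier λ g → ⟨ L ⟩ g × g ∙ x ∼ y
    translation-between dx dy with coset-representative dx | coset-representative dy
    ... | a₁ , h₁ , x∼a₁s | a₂ , h₂ , y∼a₂s =
      a₂ ∙ a₁ ⁻¹ , g∈ , ∼-trans (translate g∈ x∼a₁s) (∼-trans (here g[a₁s]≈a₂s) (∼-sym y∼a₂s))
      where
        g∈ = mul h₂ (inv h₁)
        g[a₁s]≈a₂s : (a₂ ∙ a₁ ⁻¹) ∙ (a₁ ∙ s) ≈ a₂ ∙ s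
        g[a₁s]≈a₂s = trans (assoc _ _ _) (∙-congˡ (x⁻¹∙[x∙y]≈y _ _))

    same-size : ∀ x y → DC s x → DC s y → SameSize x y
    same-size x y dx dy with translation-between dx dy
    ... | g , hg , gx∼y = record
      { to = λ a → g ∙ proj₁ a , ∼-trans (translate hg (proj₂ a)) gx∼y
      ; from = λ a → g ⁻¹ ∙ proj₁ a , ∼-trans (translate (inv hg) (proj₂ a)) g⁻¹y∼x
      ; to-cong = ∙-congˡ
      ; from-cong = ∙-congˡ
      ; inverse = (λ e → trans (∙-congˡ e) (x∙[x⁻¹∙y]≈y _ _)) , (λ e → trans (∙-congˡ e) (x⁻¹∙[x∙y]≈y _ _)) }
      where
        g⁻¹y∼x : g ⁻¹ ∙ y ∼ x
        g⁻¹y∼x = ∼-sym (∼-resp (x⁻¹∙[x∙y]≈y g x) refl (translate (inv hg) gx∼y))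

    all-isomorphic : GeneratorIsos → ∀ x y → DC s x → DC s y → IsoComponents x y
    all-isomorphic isos x y dx dy with translation-between dx dy
    ... | g , hg , gx∼y = iso-trans (subgroup-isos isos hg x) (∼⇒iso gx∼y)

theorem4p5 : ∀ {c ℓ p} (G : Group c ℓ) (L R : Pred (Group.Carrier G) p) →
    let open Group G
        open TwoSided G L R
    in
    L Respects _≈_ → R Respects _≈_ → ∃ L → ∃ R → ∀ s →
    (∀ (k : ℕ) → IsMinWCL s k → ExactlyComponents s k)
    × (NoWCL s → InfinitelyManyComponents s)
    × (∀ x y → DC s x → DC s y → SameSize x y)
    × ((Σ Carrier (λ l → L l × N L l)) ⊎ (Σ Carrier (λ r → R r × N R r)) →
       ∀ x y → DC s x → DC s y → IsoComponents x y)
theorem4p5 G L R _ _ (l₀ , hl₀) (r₀ , hr₀) s =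
  exactly-components , infinitely-many , same-size , λ hyp → all-isomorphic (normaliser-isos hyp)
  where
    open Components G L R l₀ hl₀ r₀ hr₀
    open DoubleCoset s
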